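{- Let $S$ be a word, $F=\mathit{first}(S)$ and $L=\mathit{last}(S)$. If the word $FLFL$ is a subsequence of $S$, then $FL$ is an s-cover of $S$.
   Context: For a word $S$ with set of letters $\mathrm{Alph}(S)$ of size $k$, $\mathit{first}(S)$ (resp. $\mathit{last}(S)$) is the length-$k$ word containing all letters of $\mathrm{Alph}(S)$, each once, in the order of their first (resp. last) occurrences in $S$. A word $U$ is a subsequence of $S$ if there are positions $i_0<\cdots<i_{|U|-1}$ of $S$ with $S[i_j]=U[j]$; such a sequence of positions is an occurrence of $U$ as a subsequence. $C$ is an s-cover of $S$ if every position of $S$ lies in some occurrence of $C$ as a subsequence of $S$. -}

module Defs where

open import Level using (Level)
open import Data.Nat using (ℕ)
open import Data.Fin using (Fin; _<_)
open import Data.List using (List; length; lookup; reverse; deduplicate; _++_)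
open import Data.Product using (Σ; ∃; _×_)
open import Relation.Binary.PropositionalEquality using (_≡_)
open import Relation.Binary.Definitions using (DecidableEquality)

-- first(S): letters of S in the order of their first occurrences
-- (deduplicate keeps the first occurrence of each letter).
first : ∀ {a} {A : Set a} → DecidableEquality A → List A → List A
first _≟_ S = deduplicate _≟_ S

last : ∀ {a} {A : Set a} → DecidableEquality A → List A → List A
last _≟_ S = reverse (deduplicate _≟_ (reverse S))

record Occurrence {a} {A : Set a} (U S : List A) : Set a where
  field
    pos     : Fin (length U) → Fin (length S)
    incr    : ∀ (j k : Fin (length U)) → j < k → pos j < pos k
    matches : ∀ (j : Fin (length U)) → lookup S (pos j) ≡ lookup U j

IsSubseq : ∀ {a} {A : Set a} → List A → List A → Set a
IsSubseq U S = Occurrence U S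

SCover : ∀ {a} {A : Set a} → List A → List A → Set a
SCover C S = ∀ (i : Fin (length S)) →
  Σ (Occurrence C S) λ o → ∃ λ (j : Fin (length C)) → Occurrence.pos o j ≡ i

{-# OPTIONS --safe #-}
-- Fix a position i of S and write S = S₁ x S₂ with x the letter at i. Cutting
-- F = first S and L = last S at their unique x gives F = F₁ x F₂ and L = L₁ x L₂,
-- where F₁ embeds into S₁ (its letters occur first before the first x) and L₂
-- into S₂ (symmetrically). An embedding of FL·FL into S puts one of the two
-- copies of FL entirely on one side of i. If it lies in S₁, then F L₁ ⊆ S₁,
-- the x at i, and L₂ ⊆ S₂ form an occurrence of FL through i; if it lies in S₂,
-- use F₁ ⊆ S₁, the x at i, and F₂ L ⊆ S₂.
module Submission where

open import Defs
open import Data.List using (List; _++_)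
open import Relation.Binary.Definitions using (DecidableEquality)

open import Function using (_∘_)
open import Data.Nat as ℕ using (ℕ; suc; s≤s; z≤n)
open import Data.Nat.Properties using (<-≤-trans; <⇒≤; ≤-refl)
open import Data.Fin as Fin using (Fin; zero; suc; toℕ)
open import Data.List using ([]; _∷_; [_]; length; lookup; reverse; filter)
open import Data.List.Properties using (++-assoc; reverse-++; unfold-reverse; reverse-involutive; filter-++; filter-accept)
open import Data.List.Relation.Binary.Sublist.Propositional using (_⊆_; []; _∷_; _∷ʳ_; ⊆-refl; ⊆-trans)
open import Data.List.Relation.Binary.Sublist.Propositional.Properties using ([]⊆-universal; ∷⁻; ++⁺; ++⁺ˡ; ++⁺ʳ; filter-⊆; reverse⁺)
open import Data.Product using (Σ; ∃; ∃₂; _×_; _,_)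
open import Data.Sum using (_⊎_; inj₁; inj₂; map₁)
open import Relation.Nullary using (yes; no; ¬?)
open import Relation.Binary.PropositionalEquality using (_≡_; refl; sym; trans; cong; subst; module ≡-Reasoning)

open Occurrence

module _ {a} {A : Set a} where

  position : {U S : List A} → U ⊆ S → Fin (length U) → Fin (length S)
  position (_ ∷ʳ σ) j       = suc (position σ j)
  position (_ ∷ σ)  zero    = zero
  position (_ ∷ σ)  (suc j) = suc (position σ j)

  position-mono-< : {U S : List A} (σ : U ⊆ S) (j k : Fin (length U)) →
                    j Fin.< k → position σ j Fin.< position σ k
  position-mono-< (_ ∷ʳ σ) j       k       j<k       = s≤s (position-mono-< σ j k j<k)
  position-mono-< (_ ∷ σ)  zero    (suc k) _         = s≤s z≤n
  position-mono-< (_ ∷ σ)  (suc j) (suc k) (s≤s j<k) = s≤s (position-mono-< σ j k j<k)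

  lookup-position : {U S : List A} (σ : U ⊆ S) (j : Fin (length U)) →
                    lookup S (position σ j) ≡ lookup U j
  lookup-position (_ ∷ʳ σ) j       = lookup-position σ j
  lookup-position (eq ∷ σ) zero    = sym eq
  lookup-position (_ ∷ σ)  (suc j) = lookup-position σ j

  ⊆⇒Occurrence : {U S : List A} → U ⊆ S → Occurrence U S
  ⊆⇒Occurrence σ = record
    { pos = position σ ; incr = position-mono-< σ ; matches = lookup-position σ }

  private
    unsuc : {n : ℕ} (k : Fin (suc n)) → 0 ℕ.< toℕ k → Fin n
    unsuc (suc k) _ = k

    unsuc-mono-< : {n : ℕ} (k l : Fin (suc n)) (0<k : 0 ℕ.< toℕ k) (0<l : 0 ℕ.< toℕ l) →
                   k Fin.< l → unsuc k 0<k Fin.< unsuc l 0<l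
    unsuc-mono-< (suc k) (suc l) _ _ (s≤s k<l) = k<l

    lookup-unsuc : {y : A} {S : List A} (k : Fin (length (y ∷ S))) (0<k : 0 ℕ.< toℕ k) →
                   lookup S (unsuc k 0<k) ≡ lookup (y ∷ S) k
    lookup-unsuc (suc k) _ = refl

  Occurrence-∷ʳ⁻ : {U S : List A} {y : A} (o : Occurrence U (y ∷ S)) →
                   (∀ j → 0 ℕ.< toℕ (pos o j)) → Occurrence U S
  Occurrence-∷ʳ⁻ o 0<pos = record
    { pos     = λ j → unsuc (pos o j) (0<pos j)
    ; incr    = λ j k j<k → unsuc-mono-< _ _ (0<pos j) (0<pos k) (incr o j k j<k)
    ; matches = λ j → trans (lookup-unsuc (pos o j) (0<pos j)) (matches o j)
    }

  Occurrence-∷⁻ : {u : A} {U S : List A} → Occurrence (u ∷ U) S → Occurrence U S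
  Occurrence-∷⁻ o = record
    { pos     = pos o ∘ suc
    ; incr    = λ j k j<k → incr o (suc j) (suc k) (s≤s j<k)
    ; matches = matches o ∘ suc
    }

  pos-zero-≤ : {u : A} {U S : List A} (o : Occurrence (u ∷ U) S) →
               ∀ j → pos o zero Fin.≤ pos o j
  pos-zero-≤ o zero    = ≤-refl
  pos-zero-≤ o (suc j) = <⇒≤ (incr o zero (suc j) (s≤s z≤n))

  Occurrence⇒⊆ : {U : List A} (S : List A) → Occurrence U S → U ⊆ S
  Occurrence⇒⊆ {[]}    S       o = []⊆-universal S
  Occurrence⇒⊆ {u ∷ U} []      o with () ← pos o zero
  Occurrence⇒⊆ {u ∷ U} (y ∷ S) o with pos o zero in eq
  ... | zero  = trans (sym (matches o zero)) (cong (lookup (y ∷ S)) eq)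
                ∷ Occurrence⇒⊆ S (Occurrence-∷ʳ⁻ (Occurrence-∷⁻ o) 0<pos-suc)
    where
    0<pos-suc : ∀ j → 0 ℕ.< toℕ (pos o (suc j))
    0<pos-suc j = subst (λ i → toℕ i ℕ.< toℕ (pos o (suc j))) eq (incr o zero (suc j) (s≤s z≤n))
  ... | suc _ = y ∷ʳ Occurrence⇒⊆ S (Occurrence-∷ʳ⁻ o 0<pos)
    where
    0<pos : ∀ j → 0 ℕ.< toℕ (pos o j)
    0<pos j = <-≤-trans (subst (λ i → 0 ℕ.< toℕ i) (sym eq) (s≤s z≤n)) (pos-zero-≤ o j)

  ++⊆∷-split : (U : List A) {V P Q : List A} {x : A} → U ++ V ⊆ P ++ x ∷ Q → U ⊆ P ⊎ V ⊆ Q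
  ++⊆∷-split []      {P = P}     σ = inj₁ ([]⊆-universal P)
  ++⊆∷-split (u ∷ U) {P = []}    σ = inj₂ (⊆-trans (++⁺ˡ U ⊆-refl) (∷⁻ σ))
  ++⊆∷-split (u ∷ U) {P = y ∷ P} (_ ∷ʳ σ) = map₁ (y ∷ʳ_) (++⊆∷-split (u ∷ U) σ)
  ++⊆∷-split (u ∷ U) {P = _ ∷ P} (eq ∷ σ) = map₁ (eq ∷_) (++⊆∷-split U σ)

  middle : (S₁ : List A) {x : A} {S₂ : List A} → Fin (length (S₁ ++ x ∷ S₂))
  middle []       = zero
  middle (_ ∷ S₁) = suc (middle S₁)

  data SplitAt : (S : List A) → Fin (length S) → Set a where
    split : (S₁ : List A) (x : A) (S₂ : List A) → SplitAt (S₁ ++ x ∷ S₂) (middle S₁)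

  splitAt : (S : List A) (i : Fin (length S)) → SplitAt S i
  splitAt (x ∷ S) zero    = split [] x S
  splitAt (y ∷ S) (suc i) with splitAt S i
  ... | split S₁ x S₂ = split (y ∷ S₁) x S₂

  position-++⁺-middle : {C₁ C₂ S₁ S₂ : List A} {x : A} (τ₁ : C₁ ⊆ S₁) (τ₂ : C₂ ⊆ S₂) →
                        position (++⁺ τ₁ (refl {x = x} ∷ τ₂)) (middle C₁) ≡ middle S₁
  position-++⁺-middle []        τ₂ = refl
  position-++⁺-middle (_ ∷ʳ τ₁) τ₂ = cong suc (position-++⁺-middle τ₁ τ₂)
  position-++⁺-middle (_ ∷ τ₁)  τ₂ = cong suc (position-++⁺-middle τ₁ τ₂)

  Covers : List A → (S : List A) → Fin (length S) → Set a
  Covers C S i = Σ (C ⊆ S) λ σ → ∃ λ j → position σ j ≡ i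

  covers-middle : {C C₁ C₂ S₁ S₂ : List A} {x : A} → C ≡ C₁ ++ x ∷ C₂ →
                  C₁ ⊆ S₁ → C₂ ⊆ S₂ → Covers C (S₁ ++ x ∷ S₂) (middle S₁)
  covers-middle {C₁ = C₁} refl τ₁ τ₂ = ++⁺ τ₁ (refl ∷ τ₂) , middle C₁ , position-++⁺-middle τ₁ τ₂

  square-covers-middle : {F L F₁ F₂ L₁ L₂ S₁ S₂ : List A} {x : A} →
    F ≡ F₁ ++ x ∷ F₂ → F₁ ⊆ S₁ → L ≡ L₁ ++ x ∷ L₂ → L₂ ⊆ S₂ →
    F ++ L ++ F ++ L ⊆ S₁ ++ x ∷ S₂ → Covers (F ++ L) (S₁ ++ x ∷ S₂) (middle S₁)
  square-covers-middle {F} {L} {F₁} {F₂} {L₁} {L₂} {x = x} refl F₁⊆S₁ refl L₂⊆S₂ FLFL⊆S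
    with ++⊆∷-split (F ++ L) (subst (_⊆ _) (sym (++-assoc F L (F ++ L))) FLFL⊆S)
  ... | inj₁ FL⊆S₁ = covers-middle (sym (++-assoc F L₁ (x ∷ L₂)))
                       (⊆-trans (++⁺ (⊆-refl {x = F}) (++⁺ʳ (x ∷ L₂) ⊆-refl)) FL⊆S₁) L₂⊆S₂
  ... | inj₂ FL⊆S₂ = covers-middle (++-assoc F₁ (x ∷ F₂) L)
                       F₁⊆S₁ (⊆-trans (++⁺ (++⁺ˡ F₁ (x ∷ʳ ⊆-refl)) ⊆-refl) FL⊆S₂)

  reverse-++-∷ : (P : List A) (x : A) (Q : List A) → reverse (P ++ x ∷ Q) ≡ reverse Q ++ x ∷ reverse P
  reverse-++-∷ P x Q = begin
    reverse (P ++ x ∷ Q)              ≡⟨ reverse-++ P (x ∷ Q) ⟩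
    reverse (x ∷ Q) ++ reverse P      ≡⟨ cong (_++ reverse P) (unfold-reverse x Q) ⟩
    (reverse Q ++ [ x ]) ++ reverse P ≡⟨ ++-assoc (reverse Q) [ x ] (reverse P) ⟩
    reverse Q ++ x ∷ reverse P        ∎
    where open ≡-Reasoning

  module _ (_≟_ : DecidableEquality A) where

    first-split : (S₁ : List A) (x : A) (S₂ : List A) →
                  ∃₂ λ F₁ F₂ → first _≟_ (S₁ ++ x ∷ S₂) ≡ F₁ ++ x ∷ F₂ × F₁ ⊆ S₁
    first-split []       x S₂ = [] , _ , refl , []
    first-split (y ∷ S₁) x S₂ with y ≟ x
    ... | yes refl = [] , _ , refl , []⊆-universal _
    ... | no y≢x with first-split S₁ x S₂
    ...   | F₁ , F₂ , eq , F₁⊆S₁ =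
            y ∷ filter y≢? F₁ , filter y≢? F₂ , cong (y ∷_) filtered , refl ∷ ⊆-trans (filter-⊆ y≢? F₁) F₁⊆S₁
      where
      open ≡-Reasoning
      y≢? = ¬? ∘ (y ≟_)
      filtered : filter y≢? (first _≟_ (S₁ ++ x ∷ S₂)) ≡ filter y≢? F₁ ++ x ∷ filter y≢? F₂
      filtered = begin
        filter y≢? (first _≟_ (S₁ ++ x ∷ S₂))  ≡⟨ cong (filter y≢?) eq ⟩
        filter y≢? (F₁ ++ x ∷ F₂)              ≡⟨ filter-++ y≢? F₁ (x ∷ F₂) ⟩
        filter y≢? F₁ ++ filter y≢? (x ∷ F₂)   ≡⟨ cong (filter y≢? F₁ ++_) (filter-accept y≢? y≢x) ⟩
        filter y≢? F₁ ++ x ∷ filter y≢? F₂     ∎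

    last-split : (S₁ : List A) (x : A) (S₂ : List A) →
                 ∃₂ λ L₁ L₂ → last _≟_ (S₁ ++ x ∷ S₂) ≡ L₁ ++ x ∷ L₂ × L₂ ⊆ S₂
    last-split S₁ x S₂ with first-split (reverse S₂) x (reverse S₁)
    ... | G₁ , G₂ , eq , G₁⊆ʳS₂ = reverse G₂ , reverse G₁ , reversed ,
          subst (reverse G₁ ⊆_) (reverse-involutive S₂) (reverse⁺ G₁⊆ʳS₂)
      where
      open ≡-Reasoning
      reversed : last _≟_ (S₁ ++ x ∷ S₂) ≡ reverse G₂ ++ x ∷ reverse G₁
      reversed = begin
        reverse (first _≟_ (reverse (S₁ ++ x ∷ S₂)))       ≡⟨ cong (reverse ∘ first _≟_) (reverse-++-∷ S₁ x S₂) ⟩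
        reverse (first _≟_ (reverse S₂ ++ x ∷ reverse S₁)) ≡⟨ cong reverse eq ⟩
        reverse (G₁ ++ x ∷ G₂)                             ≡⟨ reverse-++-∷ G₁ x G₂ ⟩
        reverse G₂ ++ x ∷ reverse G₁                       ∎

lemma2 : ∀ {a} {A : Set a} (_≟_ : DecidableEquality A) (S : List A) →
    IsSubseq (first _≟_ S ++ last _≟_ S ++ first _≟_ S ++ last _≟_ S) S →
    SCover (first _≟_ S ++ last _≟_ S) S
lemma2 _≟_ S occ i with splitAt S i
... | split S₁ x S₂
  with _ , _ , F≡ , F₁⊆S₁ ← first-split _≟_ S₁ x S₂
     | _ , _ , L≡ , L₂⊆S₂ ← last-split _≟_ S₁ x S₂
  with σ , j , pos≡i ← square-covers-middle F≡ F₁⊆S₁ L≡ L₂⊆S₂ (Occurrence⇒⊆ S occ)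
  = ⊆⇒Occurrence σ , j , pos≡i
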